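{- Let $q\ge 3$ be odd, let $\mathbf f\in A_q^+\setminus V$ have last symbol $0$, and let $\ell$ be the length of the maximal suffix of $\mathbf f$ consisting only of $0$s. Then for every $n\ge1$, the set $A_q^n(\mathbf f)$ listed in $\triangleleft$ order is an at most $(\ell+1)$-close $3$-Gray code: any two consecutive words in the list differ in at most $3$ positions, and the leftmost and rightmost positions where they differ are separated by at most $\ell$ symbols.
   Context: $A_q=\{0,1,\dots,q-1\}$; $A_q^n$ is the set of length-$n$ words over $A_q$, $A_q^+$ the nonempty finite words. For a set $X$ of words, $X(\mathbf f)$ is the set of words of $X$ not containing $\mathbf f$ as a factor (contiguous subword). For distinct words $\mathbf s,\mathbf t$ of equal length, with $k$ the leftmost differing position, $u=\sum_{i<k}s_i$ and $v$ the number of nonzero symbols among $s_1,\dots,s_{k-1}$, $\mathbf s\triangleleft\mathbf t$ iff ($u+v$ even and $s_k<t_k$) or ($u+v$ odd and $s_k>t_k$). $\mathbf a^i$ is $i$-fold concatenation and $\mathbf a^{ -\infty}=\cdots\mathbf a\mathbf a$; a suffix of it is a finite (possibly empty) word with which it ends. $V=\bigcup_{m\ge0}\{\mathbf b0:\mathbf b\text{ a suffix of }(10^m)^{ -\infty}\}$. -}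

module Defs where

open import Data.Nat using (ℕ; zero; suc; _+_; _%_)
open import Data.Fin using (Fin; toℕ) renaming (_<_ to _<ᶠ_)
open import Data.List using (List; []; _∷_; _++_; concat; replicate; map; reverse)
open import Data.Vec using (Vec; []; _∷_; toList)
open import Data.Product using (Σ; ∃; _×_; _,_)
open import Data.Sum using (_⊎_)
open import Relation.Binary.PropositionalEquality using (_≡_)
open import Relation.Nullary using (¬_)

Word : ℕ → ℕ → Set
Word q n = Vec (Fin q) n

IsFactor : {A : Set} → List A → List A → Set
IsFactor {A} u w = Σ (List A) λ x → Σ (List A) λ y → w ≡ x ++ u ++ y

Avoids : ∀ {q n} → List (Fin q) → Word q n → Set
Avoids f w = ¬ IsFactor f (toList w)

-- contribution of symbol x to u+v: its value plus 1 if nonzero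
weight : ℕ → ℕ
weight zero = zero
weight (suc k) = suc k + 1

-- s ◁ t, with c the accumulated value of u+v over the common prefix.
-- At the leftmost differing position: if c even need s_k < t_k, if odd s_k > t_k.
Lt : ∀ {q n} → ℕ → Word q n → Word q n → Set
Lt c [] [] = Data.Empty.⊥
  where import Data.Empty
Lt c (x ∷ s) (y ∷ t) =
  (x ≡ y × Lt (c + weight (toℕ x)) s t)
  ⊎ ((c % 2 ≡ 0 × x <ᶠ y) ⊎ (c % 2 ≡ 1 × y <ᶠ x))

_◁_ : ∀ {q n} → Word q n → Word q n → Set
s ◁ t = Lt 0 s t

diffCount : ∀ {q n} → Word q n → Word q n → ℕ
diffCount [] [] = 0
diffCount (x ∷ s) (y ∷ t) with Data.Fin._≟_ x y
  where import Data.Fin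
... | Relation.Nullary.yes _ = diffCount s t
... | Relation.Nullary.no _ = suc (diffCount s t)

block : ℕ → ℕ → List ℕ
block m j = concat (replicate j (1 ∷ replicate m 0))

-- f ∈ V : f = b0 with b a (finite, possibly empty) suffix of (1 0^m)^{-∞} for some m;
-- a finite suffix of (1 0^m)^{-∞} is exactly a suffix of (1 0^m)^j for some j.
InV : ∀ {q} → List (Fin q) → Set
InV f = ∃ λ m → ∃ λ j → ∃ λ p → ∃ λ b →
  (p ++ b ≡ block m j) × (map toℕ f ≡ b ++ (0 ∷ []))

leadZeros : ∀ {q} → List (Fin q) → ℕ
leadZeros [] = 0
leadZeros (x ∷ xs) with toℕ x
... | zero = suc (leadZeros xs)
... | suc _ = 0

trailZeros : ∀ {q} → List (Fin q) → ℕ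
trailZeros f = leadZeros (reverse f)

module Submission where

-- Let q = 3 + r be odd and f = g0.  A word is read from left to right while
-- keeping its history h, the reversed prefix read so far; the word avoids f
-- iff no history starts with 0R, where R = reverse g.  So the symbol 0 is
-- forbidden exactly when R is a prefix of h, and nonzero symbols are always
-- allowed.  Since f ∉ V, R contains a nonzero symbol: R = 0^j d R' with d ≠ 0,
-- and trailZeros f = j + 1.
--
-- Flipping the parity of the counter reverses the order Lt, so
--    "last completion" is "first completion for the opposite parity", and the
--    odd case of the main induction reduces to the even one.
--  * Greedy completion.  Writing 1 when R ⊑ h and 0 otherwise yields the first
--    completion in even parity; in odd parity the first completion is
--    top = q - 1 (of odd weight q) followed by the greedy completion.
--  * Spikes.  After a nonzero symbol e the greedy completion is 0^j E 0 0 ...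
--    with E ∈ {0, 1} and E = 1 only if d = e.  That no second 1 appears is where
--    f ∉ V enters: R cannot occur both at Y and at 0^j 1 Y (periodicity lemma).
--  * Two ◁-consecutive words agree up to a position carrying adjacent symbols;
--    there one continues with its last and the other with its first completion,
--    and these spikes differ in at most two more places within j + 1 positions.

open import Defs
open import Data.Nat using (ℕ; zero; suc; _+_; _≤_; _<_; _%_; _∸_; z≤n; s≤s)
open import Data.Nat.Properties
  using (≤-refl; ≤-trans; ≤-reflexive; <-≤-trans; ≤∧≢⇒<; m≤n⇒m<n∨m≡n; 1+n≢n; n≮0; n≤1+n;
         m<n+m; m<m+n; m≤n+m; m∸n≤m; 0∸n≡0; +-suc; +-comm; +-assoc; +-identityʳ; +-mono-≤;
         pred-mono-≤; module ≤-Reasoning)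
open import Data.Nat.DivMod using (%-distribˡ-+; m%n%n≡m%n)
open import Data.Fin as Fin using (Fin; zero; suc; toℕ; fromℕ; fromℕ<)
open import Data.Fin.Properties using (toℕ-fromℕ; toℕ-fromℕ<; toℕ-injective; toℕ<n; ≤fromℕ)
open import Data.List
  using (List; []; _∷_; _++_; _∷ʳ_; _ʳ++_; [_]; replicate; reverse; concat; length; map)
open import Data.List.Properties
  using (map-replicate; map-++; ++-assoc; ++-identityʳ; reverse-++; reverse-involutive;
         unfold-reverse; length-++)
open import Data.List.Relation.Binary.Prefix.Heterogeneous
  using (Prefix; []; _∷_; _++ᵖ_; toView) renaming (head to ⊑-head; _++_ to _⟨++⟩_)
import Data.List.Relation.Binary.Prefix.Heterogeneous.Properties as Prefix
import Data.List.Relation.Binary.Pointwise as Pointwise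
open import Data.Vec as Vec using (Vec; []; _∷_; toList; lookup)
open import Data.Vec.Properties using (lookup-replicate)
open import Data.Product using (Σ; ∃; _×_; _,_)
open import Data.Sum using (_⊎_; inj₁; inj₂) renaming (map to map⊎)
open import Data.Empty using (⊥; ⊥-elim)
open import Function using (_∘_)
open import Relation.Binary.PropositionalEquality
  using (_≡_; _≢_; refl; sym; trans; cong; cong₂; subst; subst₂; module ≡-Reasoning)
open import Relation.Nullary using (¬_; Dec; yes; no)

-- Prefixes, periodicity and reversal, for lists over any type.

module _ {A : Set} where

  infix 4 _⊑_
  _⊑_ : List A → List A → Set
  _⊑_ = Prefix _≡_

  ⊑-++ : ∀ (a l : List A) → a ⊑ a ++ l
  ⊑-++ a l = Prefix.fromPointwise (Pointwise.refl refl) ++ᵖ l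

  ⊑-rest : ∀ {a b : List A} → a ⊑ b → ∃ λ rest → a ++ rest ≡ b
  ⊑-rest a⊑b with toView a⊑b
  ... | a≈c ⟨++⟩ rest = rest , cong (_++ rest) (Pointwise.Pointwise-≡⇒≡ a≈c)

  ⊑-comparable : ∀ {a b z : List A} → a ⊑ z → b ⊑ z → length a ≤ length b → a ⊑ b
  ⊑-comparable [] _ _ = []
  ⊑-comparable (refl ∷ a⊑z) (refl ∷ b⊑z) (s≤s le) = refl ∷ ⊑-comparable a⊑z b⊑z le

  self-overlap : ∀ {R Y P : List A} → R ⊑ Y → R ⊑ P ++ Y → R ⊑ P ++ R
  self-overlap {R} {Y} {P} R⊑Y R⊑PY = ⊑-comparable R⊑PY (Prefix.++⁺ (Pointwise.refl refl) R⊑Y)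
    (≤-trans (m≤n+m (length R) (length P)) (≤-reflexive (sym (length-++ P))))

  ⊑-split : ∀ (P : List A) {a B} → a ⊑ P ++ B → a ⊑ P ⊎ ∃ λ a' → a ≡ P ++ a' × a' ⊑ B
  ⊑-split [] {a} a⊑B = inj₂ (a , refl , a⊑B)
  ⊑-split (x ∷ P) [] = inj₁ []
  ⊑-split (x ∷ P) (refl ∷ a⊑PB) with ⊑-split P a⊑PB
  ... | inj₁ a⊑P = inj₁ (refl ∷ a⊑P)
  ... | inj₂ (a' , refl , a'⊑B) = inj₂ (a' , refl , a'⊑B)

  repeat : List A → ℕ → List A
  repeat P k = concat (replicate k P)

  length-++-< : ∀ (P a : List A) → 1 ≤ length P → length a < length (P ++ a)
  length-++-< P a P≢[] = <-≤-trans (m<n+m (length a) P≢[]) (≤-reflexive (sym (length-++ P)))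

  -- Periodicity: a word that is a prefix of P followed by itself is a prefix
  -- of a power of P.  The argument n bounds the length of the word.
  periodic : ∀ (P : List A) → 1 ≤ length P → ∀ n (a : List A) → length a ≤ n →
             a ⊑ P ++ a → ∃ λ k → a ⊑ repeat P k
  periodic P P≢[] n a a≤n a⊑Pa with ⊑-split P a⊑Pa
  ... | inj₁ a⊑P = 1 , a⊑P ++ᵖ []
  ... | inj₂ (a' , refl , a'⊑Pa') with n | <-≤-trans (length-++-< P a' P≢[]) a≤n
  ...   | zero | ()
  ...   | suc n | a'<n with periodic P P≢[] n a' (pred-mono-≤ a'<n) a'⊑Pa'
  ...     | k , a'⊑Pᵏ = suc k , Prefix.++⁺ (Pointwise.refl refl) a'⊑Pᵏ

  replicate-∷ʳ : ∀ n (x : A) → replicate n x ∷ʳ x ≡ x ∷ replicate n x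
  replicate-∷ʳ zero x = refl
  replicate-∷ʳ (suc n) x = cong (x ∷_) (replicate-∷ʳ n x)

  reverse-replicate : ∀ n (x : A) → reverse (replicate n x) ≡ replicate n x
  reverse-replicate zero x = refl
  reverse-replicate (suc n) x = begin
    reverse (x ∷ replicate n x)  ≡⟨ unfold-reverse x (replicate n x) ⟩
    reverse (replicate n x) ∷ʳ x ≡⟨ cong (_∷ʳ x) (reverse-replicate n x) ⟩
    replicate n x ∷ʳ x           ≡⟨ replicate-∷ʳ n x ⟩
    x ∷ replicate n x            ∎
    where open ≡-Reasoning

  repeat-comm : ∀ (P : List A) k → repeat P k ++ P ≡ P ++ repeat P k
  repeat-comm P zero = sym (++-identityʳ P)
  repeat-comm P (suc k) = trans (++-assoc P (repeat P k) P) (cong (P ++_) (repeat-comm P k))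

  reverse-repeat : ∀ (P : List A) k → reverse (repeat P k) ≡ repeat (reverse P) k
  reverse-repeat P zero = refl
  reverse-repeat P (suc k) = begin
    reverse (P ++ repeat P k)                ≡⟨ reverse-++ P (repeat P k) ⟩
    reverse (repeat P k) ++ reverse P        ≡⟨ cong (_++ reverse P) (reverse-repeat P k) ⟩
    repeat (reverse P) k ++ reverse P        ≡⟨ repeat-comm (reverse P) k ⟩
    reverse P ++ repeat (reverse P) k        ∎
    where open ≡-Reasoning

  factor-reverse : ∀ {u l : List A} → IsFactor u l → IsFactor (reverse u) (reverse l)
  factor-reverse {u} {l} (x , y , refl) = reverse y , reverse x , (begin
    reverse (x ++ u ++ y)                      ≡⟨ reverse-++ x (u ++ y) ⟩
    reverse (u ++ y) ++ reverse x              ≡⟨ cong (_++ reverse x) (reverse-++ u y) ⟩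
    (reverse y ++ reverse u) ++ reverse x      ≡⟨ ++-assoc (reverse y) (reverse u) (reverse x) ⟩
    reverse y ++ reverse u ++ reverse x        ∎)
    where open ≡-Reasoning

  factor-reverse⁻ : ∀ {u l : List A} → IsFactor (reverse u) (reverse l) → IsFactor u l
  factor-reverse⁻ {u} {l} i =
    subst₂ IsFactor (reverse-involutive u) (reverse-involutive l) (factor-reverse i)

  -- Avoiding u l: no suffix of l starts with u, checked position by position.
  -- Read on histories, this says that the word read so far avoids reverse u.
  data Avoiding (u : List A) : List A → Set where
    nil  : Avoiding u []
    cons : ∀ {x l} → ¬ u ⊑ x ∷ l → Avoiding u l → Avoiding u (x ∷ l)

  avoiding-drop : ∀ {u} (xs : List A) {h} → Avoiding u (xs ʳ++ h) → Avoiding u h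
  avoiding-drop [] av = av
  avoiding-drop (x ∷ xs) av with avoiding-drop xs av
  ... | cons _ av' = av'

  avoiding⇒¬factor : ∀ {a u} l → Avoiding (a ∷ u) l → ¬ IsFactor (a ∷ u) l
  avoiding⇒¬factor {a} {u} .(x ++ a ∷ u ++ y) av (x , y , refl) = go x av
    where
      go : ∀ x → Avoiding (a ∷ u) (x ++ a ∷ u ++ y) → ⊥
      go [] (cons u⋢ _) = u⋢ (⊑-++ (a ∷ u) y)
      go (_ ∷ x) (cons _ av) = go x av

  ¬factor⇒avoiding : ∀ {u} l → ¬ IsFactor u l → Avoiding u l
  ¬factor⇒avoiding [] _ = nil
  ¬factor⇒avoiding (x ∷ l) ¬f =
    cons (λ u⊑ → let rest , eq = ⊑-rest u⊑ in ¬f ([] , rest , sym eq))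
         (¬factor⇒avoiding l λ { (a , b , eq) → ¬f (x ∷ a , b , cong (x ∷_) eq) })

%2-+ : ∀ c a {b e} → c % 2 ≡ b → a % 2 ≡ e → (c + a) % 2 ≡ (b + e) % 2
%2-+ c a refl refl = %-distribˡ-+ c a 2

parity : ∀ n → n % 2 ≡ 0 ⊎ n % 2 ≡ 1
parity zero = inj₁ refl
parity (suc zero) = inj₂ refl
parity (suc (suc n)) = map⊎ (%2-+ 2 n refl) (%2-+ 2 n refl) (parity n)

suc-even : ∀ c → c % 2 ≡ 0 → suc c % 2 ≡ 1
suc-even c = %2-+ 1 c refl

suc-odd : ∀ c → c % 2 ≡ 1 → suc c % 2 ≡ 0
suc-odd c = %2-+ 1 c refl

%2-cong : ∀ c c' a → c % 2 ≡ c' % 2 → (c + a) % 2 ≡ (c' + a) % 2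
%2-cong c c' a eq = begin
  (c + a) % 2               ≡⟨ %-distribˡ-+ c a 2 ⟩
  (c % 2 + a % 2) % 2       ≡⟨ cong (λ v → (v + a % 2) % 2) eq ⟩
  (c' % 2 + a % 2) % 2      ≡⟨ %-distribˡ-+ c' a 2 ⟨
  (c' + a) % 2              ∎
  where open ≡-Reasoning

Lt-parity : ∀ {q n c c'} {s t : Word q n} → c % 2 ≡ c' % 2 → Lt c s t → Lt c' s t
Lt-parity {s = []} {[]} _ ()
Lt-parity {c = c} {c'} {x ∷ _} {_ ∷ _} eq (inj₁ (refl , s<t)) =
  inj₁ (refl , Lt-parity (%2-cong c c' (weight (toℕ x)) eq) s<t)
Lt-parity {s = _ ∷ _} {_ ∷ _} eq (inj₂ (inj₁ (even , x<y))) = inj₂ (inj₁ (trans (sym eq) even , x<y))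
Lt-parity {s = _ ∷ _} {_ ∷ _} eq (inj₂ (inj₂ (odd , y<x))) = inj₂ (inj₂ (trans (sym eq) odd , y<x))

Lt-flip : ∀ {q n} c {s t : Word q n} → Lt c s t → Lt (suc c) t s
Lt-flip c {[]} {[]} ()
Lt-flip c {x ∷ _} {_ ∷ _} (inj₁ (refl , s<t)) = inj₁ (refl , Lt-flip (c + weight (toℕ x)) s<t)
Lt-flip c {_ ∷ _} {_ ∷ _} (inj₂ (inj₁ (even , x<y))) = inj₂ (inj₂ (suc-even c even , x<y))
Lt-flip c {_ ∷ _} {_ ∷ _} (inj₂ (inj₂ (odd , y<x))) = inj₂ (inj₁ (suc-odd c odd , y<x))

Lt-unflip : ∀ {q n c} {s t : Word q n} → Lt (suc c) s t → Lt c t s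
Lt-unflip {c = c} s<t = Lt-parity (trans (%2-+ 2 c refl refl) (m%n%n≡m%n c 2)) (Lt-flip (suc c) s<t)

diffCount-same : ∀ {q m} (x : Fin q) (a b : Word q m) → diffCount (x ∷ a) (x ∷ b) ≡ diffCount a b
diffCount-same x a b with x Fin.≟ x
... | yes _ = refl
... | no x≢x = ⊥-elim (x≢x refl)

diffCount-∷ : ∀ {q m} (x y : Fin q) (a b : Word q m) → diffCount (x ∷ a) (y ∷ b) ≤ suc (diffCount a b)
diffCount-∷ x y a b with x Fin.≟ y
... | yes _ = n≤1+n _
... | no _ = ≤-refl

diffCount-sym : ∀ {q m} (a b : Word q m) → diffCount a b ≡ diffCount b a
diffCount-sym [] [] = refl
diffCount-sym (x ∷ a) (y ∷ b) with x Fin.≟ y | y Fin.≟ x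
... | yes _ | yes _ = diffCount-sym a b
... | no _ | no _ = cong suc (diffCount-sym a b)
... | yes x≡y | no y≢x = ⊥-elim (y≢x (sym x≡y))
... | no x≢y | yes y≡x = ⊥-elim (x≢y (sym y≡x))

isNonzero : ∀ {q} → Fin (suc q) → ℕ
isNonzero zero = 0
isNonzero (suc _) = 1

isNonzero≤1 : ∀ {q} (x : Fin (suc q)) → isNonzero x ≤ 1
isNonzero≤1 zero = z≤n
isNonzero≤1 (suc _) = ≤-refl

nonzeros : ∀ {q m} → Word (suc q) m → ℕ
nonzeros [] = 0
nonzeros (x ∷ a) = isNonzero x + nonzeros a

diffCount-nonzeros : ∀ {q m} (a b : Word (suc q) m) → diffCount a b ≤ nonzeros a + nonzeros b
diffCount-nonzeros [] [] = z≤n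
diffCount-nonzeros (zero ∷ a) (zero ∷ b) =
  ≤-trans (≤-reflexive (diffCount-same zero a b)) (diffCount-nonzeros a b)
diffCount-nonzeros (zero ∷ a) (suc y ∷ b) =
  ≤-trans (diffCount-∷ zero (suc y) a b)
          (≤-trans (s≤s (diffCount-nonzeros a b)) (≤-reflexive (sym (+-suc _ _))))
diffCount-nonzeros (suc x ∷ a) (y ∷ b) =
  ≤-trans (diffCount-∷ (suc x) y a b)
          (s≤s (≤-trans (diffCount-nonzeros a b) (+-mono-≤ (≤-refl {nonzeros a}) (m≤n+m _ _))))

Close : ∀ {q m} → ℕ → Word q m → Word q m → Set
Close {m = m} B s t = diffCount s t ≤ 3 ×
  ((i k : Fin m) → lookup s i ≢ lookup t i → lookup s k ≢ lookup t k → toℕ k ∸ toℕ i ≤ B)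

Close-∷ : ∀ {q m B} x {s t : Word q m} → Close B s t → Close B (x ∷ s) (x ∷ t)
Close-∷ x {s} {t} (few , window) = ≤-trans (≤-reflexive (diffCount-same x s t)) few , window'
  where
    window' : ∀ i k → lookup (x ∷ s) i ≢ lookup (x ∷ t) i → lookup (x ∷ s) k ≢ lookup (x ∷ t) k → _
    window' zero _ x≢x _ = ⊥-elim (x≢x refl)
    window' (suc i) zero _ _ = z≤n
    window' (suc i) (suc k) di dk = window i k di dk

Close-sym : ∀ {q m B} {s t : Word q m} → Close B s t → Close B t s
Close-sym {s = s} {t} (few , window) =
  subst (_≤ 3) (diffCount-sym s t) few , λ i k di dk → window i k (di ∘ sym) (dk ∘ sym)

Confined : ∀ {q m} → ℕ → Word (suc q) m → Set
Confined b U = ∀ i → lookup U i ≢ zero → toℕ i ≤ b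

differ⇒nonzero : ∀ {q} {a b : Fin (suc q)} → a ≢ b → a ≢ zero ⊎ b ≢ zero
differ⇒nonzero {a = zero} {zero} a≢b = ⊥-elim (a≢b refl)
differ⇒nonzero {a = zero} {suc _} _ = inj₂ λ ()
differ⇒nonzero {a = suc _} _ = inj₁ λ ()

close-heads : ∀ {q m b} {x y : Fin (suc q)} {U V : Word (suc q) m} → x ≢ y →
              diffCount U V ≤ 2 → Confined b U → Confined b V → Close (b + 1) (x ∷ U) (y ∷ V)
close-heads {b = b} {x} {y} {U} {V} _ few cU cV = ≤-trans (diffCount-∷ x y U V) (s≤s few) , window
  where
    window : ∀ i k → lookup (x ∷ U) i ≢ lookup (y ∷ V) i → lookup (x ∷ U) k ≢ lookup (y ∷ V) k →
             toℕ k ∸ toℕ i ≤ b + 1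
    window i zero _ _ = ≤-trans (≤-reflexive (0∸n≡0 (toℕ i))) z≤n
    window i (suc k) _ dk =
      ≤-trans (m∸n≤m (suc (toℕ k)) (toℕ i)) (≤-trans (s≤s k≤b) (≤-reflexive (+-comm 1 b)))
      where
        k≤b : toℕ k ≤ b
        k≤b with differ⇒nonzero dk
        ... | inj₁ U≢0 = cU k U≢0
        ... | inj₂ V≢0 = cV k V≢0

zeros : ∀ {q} m → Word (suc q) m
zeros m = Vec.replicate m zero

spike : ∀ {q} → ℕ → Fin (suc q) → (m : ℕ) → Word (suc q) m
spike k E zero = []
spike zero E (suc m) = E ∷ zeros m
spike (suc k) E (suc m) = zero ∷ spike k E m

spike-zero : ∀ {q} k m → spike {q} k zero m ≡ zeros m
spike-zero k zero = refl
spike-zero zero (suc m) = refl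
spike-zero (suc k) (suc m) = cong (zero ∷_) (spike-zero k m)

nonzeros-zeros : ∀ {q} m → nonzeros (zeros {q} m) ≡ 0
nonzeros-zeros zero = refl
nonzeros-zeros (suc m) = nonzeros-zeros m

nonzeros-spike : ∀ {q} k (E : Fin (suc q)) m → nonzeros (spike k E m) ≤ isNonzero E
nonzeros-spike k E zero = z≤n
nonzeros-spike zero E (suc m) = ≤-reflexive (trans (cong (isNonzero E +_) (nonzeros-zeros m)) (+-identityʳ _))
nonzeros-spike (suc k) E (suc m) = nonzeros-spike k E m

spike-confined : ∀ {q b} k (E : Fin (suc q)) m → k ≤ b → Confined b (spike k E m)
spike-confined zero E (suc m) _ zero _ = z≤n
spike-confined zero E (suc m) _ (suc i) E≢0 = ⊥-elim (E≢0 (lookup-replicate i zero))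
spike-confined (suc k) E (suc m) _ zero 0≢0 = ⊥-elim (0≢0 refl)
spike-confined (suc k) E (suc m) (s≤s k≤b) (suc i) E≢0 = s≤s (spike-confined k E m k≤b i E≢0)

confined-∷ : ∀ {q m b} x {U : Word (suc q) m} → Confined b U → Confined (suc b) (x ∷ U)
confined-∷ x cU zero _ = z≤n
confined-∷ x cU (suc i) U≢0 = s≤s (cU i U≢0)

spikes-differ : ∀ {q} k (E₁ E₂ : Fin (suc q)) m → diffCount (spike k E₁ m) (spike k E₂ m) ≤ 2
spikes-differ k E₁ E₂ m = begin
  diffCount (spike k E₁ m) (spike k E₂ m)
    ≤⟨ diffCount-nonzeros (spike k E₁ m) (spike k E₂ m) ⟩
  nonzeros (spike k E₁ m) + nonzeros (spike k E₂ m)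
    ≤⟨ +-mono-≤ (nonzeros-spike k E₁ m) (nonzeros-spike k E₂ m) ⟩
  isNonzero E₁ + isNonzero E₂
    ≤⟨ +-mono-≤ (isNonzero≤1 E₁) (isNonzero≤1 E₂) ⟩
  2 ∎
  where open ≤-Reasoning

one-spike : ∀ {q} {E₁ E₂ : Fin (suc q)} → E₁ ≡ zero ⊎ E₂ ≡ zero → isNonzero E₁ + isNonzero E₂ ≤ 1
one-spike {E₂ = E₂} (inj₁ refl) = isNonzero≤1 E₂
one-spike {E₁ = E₁} (inj₂ refl) = ≤-trans (≤-reflexive (+-identityʳ _)) (isNonzero≤1 E₁)

-- The three pairs of tails occurring after a pair of adjacent symbols.
close-plain : ∀ {q m} k {x y E₁ E₂ : Fin (suc q)} → x ≢ y →
              Close (suc k + 1) (x ∷ spike k E₁ m) (y ∷ spike k E₂ m)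
close-plain {m = m} k {E₁ = E₁} {E₂} x≢y =
  close-heads x≢y (spikes-differ k E₁ E₂ m)
    (spike-confined k E₁ m (n≤1+n k)) (spike-confined k E₂ m (n≤1+n k))

close-topped : ∀ {q m} k {x y t E₁ E₂ : Fin (suc q)} → x ≢ y →
               Close (suc k + 1) (x ∷ t ∷ spike k E₁ m) (y ∷ t ∷ spike k E₂ m)
close-topped {m = m} k {t = t} {E₁} {E₂} x≢y =
  close-heads x≢y (≤-trans (≤-reflexive (diffCount-same t _ _)) (spikes-differ k E₁ E₂ m))
    (confined-∷ t (spike-confined k E₁ m ≤-refl)) (confined-∷ t (spike-confined k E₂ m ≤-refl))

close-mixed : ∀ {q m} k {x y t E₁ E₂ : Fin (suc q)} → x ≢ y → E₁ ≡ zero ⊎ E₂ ≡ zero →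
              Close (suc k + 1) (x ∷ t ∷ spike k E₁ m) (y ∷ spike k E₂ (suc m))
close-mixed {m = m} k {t = t} {E₁} {E₂} x≢y one-zero =
  close-heads x≢y few (confined-∷ t (spike-confined k E₁ m ≤-refl)) (spike-confined k E₂ (suc m) (n≤1+n k))
  where
    open ≤-Reasoning
    few : diffCount (t ∷ spike k E₁ m) (spike k E₂ (suc m)) ≤ 2
    few = begin
      diffCount (t ∷ spike k E₁ m) (spike k E₂ (suc m))
        ≤⟨ diffCount-nonzeros (t ∷ spike k E₁ m) (spike k E₂ (suc m)) ⟩
      (isNonzero t + nonzeros (spike k E₁ m)) + nonzeros (spike k E₂ (suc m))
        ≡⟨ +-assoc (isNonzero t) _ _ ⟩
      isNonzero t + (nonzeros (spike k E₁ m) + nonzeros (spike k E₂ (suc m)))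
        ≤⟨ +-mono-≤ (isNonzero≤1 t) (+-mono-≤ (nonzeros-spike k E₁ m) (nonzeros-spike k E₂ (suc m))) ⟩
      1 + (isNonzero E₁ + isNonzero E₂)
        ≤⟨ s≤s (one-spike one-zero) ⟩
      2 ∎

zeros-then-nonzero : ∀ {q} k {d : Fin (suc q)} {X h} → d ≢ zero →
                     replicate k zero ++ d ∷ X ⊑ h → ¬ replicate (suc k) zero ⊑ h
zeros-then-nonzero zero d≢0 (d≡y ∷ _) (0≡y ∷ _) = d≢0 (trans d≡y (sym 0≡y))
zeros-then-nonzero (suc k) d≢0 (refl ∷ p) (refl ∷ p') = zeros-then-nonzero k d≢0 p p'

zeros-too-long : ∀ {q} i k {e : Fin (suc q)} {X h} → e ≢ zero → i < k →
                 ¬ replicate k zero ++ X ⊑ replicate i zero ++ e ∷ h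
zeros-too-long zero (suc k) e≢0 _ (0≡e ∷ _) = e≢0 (sym 0≡e)
zeros-too-long (suc i) (suc k) e≢0 (s≤s i<k) (_ ∷ p) = zeros-too-long i k e≢0 i<k p

zeros-shorten : ∀ {q} n {h : List (Fin (suc q))} → replicate (suc n) zero ⊑ h → replicate n zero ⊑ h
zeros-shorten n = Prefix.trans trans (Prefix.replicate⁺ (n≤1+n n) refl)

adjacent-symbols : ∀ {q} (x y : Fin q) → toℕ x < toℕ y →
                   (∀ z → toℕ x < toℕ z → toℕ z < toℕ y → ⊥) → toℕ y ≡ suc (toℕ x)
adjacent-symbols {q} x y x<y nothing-between with m≤n⇒m<n∨m≡n x<y
... | inj₂ eq = sym eq
... | inj₁ x+1<y =
  ⊥-elim (nothing-between z (≤-reflexive (sym z≡x+1)) (≤-trans (s≤s (≤-reflexive z≡x+1)) x+1<y))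
  where
    z : Fin q
    z = fromℕ< (<-≤-trans x+1<y (≤-trans (n≤1+n _) (toℕ<n y)))
    z≡x+1 : toℕ z ≡ suc (toℕ x)
    z≡x+1 = toℕ-fromℕ< _

above⇒nonzero : ∀ {q} {x z : Fin (suc q)} → toℕ x < toℕ z → z ≢ zero
above⇒nonzero x<z refl = n≮0 x<z

-- Consequences of f = g0 ∉ V.

leading-zeros-split : ∀ {q} (R : List (Fin (suc q))) →
  R ≡ replicate (leadZeros R) zero ⊎
  Σ (Fin (suc q)) λ d → Σ (List (Fin (suc q))) λ R' → d ≢ zero × R ≡ replicate (leadZeros R) zero ++ d ∷ R'
leading-zeros-split [] = inj₁ refl
leading-zeros-split (zero ∷ R) with leading-zeros-split R
... | inj₁ eq = inj₁ (cong (zero ∷_) eq)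
... | inj₂ (d , R' , d≢0 , eq) = inj₂ (d , R' , d≢0 , cong (zero ∷_) eq)
leading-zeros-split (suc x ∷ R) = inj₂ (suc x , R , (λ ()) , refl)

-- 0^(n+1) = b0 with b = 0^n a suffix of (1 0^n)^1.
zeros∈V : ∀ {q} n → InV (replicate {A = Fin (suc q)} n zero ∷ʳ zero)
zeros∈V n = n , 1 , [ 1 ] , replicate n 0 , sym (++-identityʳ _) ,
  trans (map-++ toℕ (replicate n zero) [ zero ]) (cong (_++ [ 0 ]) (map-replicate toℕ n zero))

nonzero-in-g : ∀ {q} (g : List (Fin (suc q))) → ¬ InV (g ∷ʳ zero) →
  Σ (Fin (suc q)) λ d → Σ (List (Fin (suc q))) λ R' →
    d ≢ zero × reverse g ≡ replicate (leadZeros (reverse g)) zero ++ d ∷ R'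
nonzero-in-g g g0∉V with leading-zeros-split (reverse g)
... | inj₂ split = split
... | inj₁ all-zero = ⊥-elim (g0∉V (subst (λ g → InV (g ∷ʳ zero)) (sym g-zeros) (zeros∈V _)))
  where
    g-zeros : g ≡ replicate (leadZeros (reverse g)) zero
    g-zeros = trans (sym (reverse-involutive g))
                    (trans (cong reverse all-zero) (reverse-replicate _ zero))

trailZeros-∷ʳ-zero : ∀ {q} (g : List (Fin (suc q))) → trailZeros (g ∷ʳ zero) ≡ suc (leadZeros (reverse g))
trailZeros-∷ʳ-zero g = cong leadZeros (reverse-++ g [ zero ])

block-repeat : ∀ {q} m k → map toℕ (repeat (suc {suc q} zero ∷ replicate m zero) k) ≡ block m k
block-repeat m zero = refl
block-repeat m (suc k) = trans (map-++ toℕ (suc zero ∷ replicate m zero) _)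
  (cong₂ _++_ (cong (1 ∷_) (map-replicate toℕ m zero)) (block-repeat m k))

suffix-of-block : ∀ {q} (g : List (Fin (suc (suc q)))) j k rest →
  reverse g ++ rest ≡ repeat (replicate j zero ++ [ suc zero ]) k →
  map toℕ (reverse rest) ++ map toℕ g ≡ block j k
suffix-of-block {q} g j k rest R++rest≡Pᵏ = begin
  map toℕ (reverse rest) ++ map toℕ g          ≡⟨ map-++ toℕ (reverse rest) g ⟨
  map toℕ (reverse rest ++ g)                  ≡⟨ cong (map toℕ ∘ (reverse rest ++_)) (reverse-involutive g) ⟨
  map toℕ (reverse rest ++ reverse (reverse g)) ≡⟨ cong (map toℕ) (reverse-++ (reverse g) rest) ⟨
  map toℕ (reverse (reverse g ++ rest))        ≡⟨ cong (map toℕ ∘ reverse) R++rest≡Pᵏ ⟩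
  map toℕ (reverse (repeat P k))               ≡⟨ cong (map toℕ) (reverse-repeat P k) ⟩
  map toℕ (repeat (reverse P) k)               ≡⟨ cong (λ P' → map toℕ (repeat P' k)) reverse-P ⟩
  map toℕ (repeat (suc zero ∷ replicate j zero) k) ≡⟨ block-repeat j k ⟩
  block j k                                     ∎
  where
    open ≡-Reasoning
    P : List (Fin (suc (suc q)))
    P = replicate j zero ++ [ suc zero ]
    reverse-P : reverse P ≡ suc zero ∷ replicate j zero
    reverse-P = trans (reverse-++ (replicate j zero) [ suc zero ])
                      (cong (suc zero ∷_) (reverse-replicate j zero))

-- No overlap: R = reverse g cannot be a prefix of both Y and 0^j 1 Y, for then
-- R would have period 0^j 1, making g a suffix of (1 0^j)^k and g0 ∈ V.
no-overlap : ∀ {q} (g : List (Fin (suc (suc q)))) j → ¬ InV (g ∷ʳ zero) →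
             ∀ Y → reverse g ⊑ Y → ¬ reverse g ⊑ replicate j zero ++ suc zero ∷ Y
no-overlap g j g0∉V Y R⊑Y R⊑PY
  with periodic (replicate j zero ++ [ suc zero ])
         (≤-trans (m≤n+m 1 _) (≤-reflexive (sym (length-++ (replicate j zero)))))
         (length (reverse g)) (reverse g) ≤-refl
         (self-overlap R⊑Y (subst (reverse g ⊑_) (sym (++-assoc (replicate j zero) _ Y)) R⊑PY))
... | k , R⊑Pᵏ with ⊑-rest R⊑Pᵏ
... | rest , R++rest≡Pᵏ =
  g0∉V (j , k , map toℕ (reverse rest) , map toℕ g ,
        suffix-of-block g j k rest R++rest≡Pᵏ , map-++ toℕ g [ zero ])

module FixedPattern (r : ℕ) (q-odd : (3 + r) % 2 ≡ 1) (g : List (Fin (3 + r)))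
  (g0∉V : ¬ InV (g ∷ʳ zero)) (j : ℕ) (d : Fin (3 + r)) (R' : List (Fin (3 + r)))
  (d≢0 : d ≢ zero) (R-shape : reverse g ≡ replicate j zero ++ d ∷ R') where

  A : Set
  A = Fin (3 + r)

  R : List A
  R = reverse g

  one top : A
  one = suc zero
  top = fromℕ (2 + r)

  top≢0 : top ≢ zero
  top≢0 ()

  below-top : ∀ {y : A} → y ≢ top → toℕ y < toℕ top
  below-top y≢top = ≤∧≢⇒< (≤fromℕ _) (y≢top ∘ toℕ-injective)

  -- The weight of top is q, which is odd.
  after-top : ∀ c → c % 2 ≡ 1 → (c + weight (toℕ top)) % 2 ≡ 0
  after-top c odd = %2-+ c _ odd (subst (λ w → w % 2 ≡ 1) weight-top q-odd)
    where
      weight-top : 3 + r ≡ weight (toℕ top)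
      weight-top = trans (+-comm 1 (2 + r)) (cong weight (sym (toℕ-fromℕ (2 + r))))

  -- Histories: h is the reversed prefix read so far; after h w reads w on.
  Av : List A → Set
  Av = Avoiding (zero ∷ R)

  after : ∀ {m} → List A → Vec A m → List A
  after h w = toList w ʳ++ h

  R? : ∀ h → Dec (R ⊑ h)
  R? = Prefix.prefix? Fin._≟_ R

  zero-blocked : ∀ {h} → R ⊑ h → ¬ Av (zero ∷ h)
  zero-blocked R⊑h (cons blocked _) = blocked (refl ∷ R⊑h)

  zero-allowed : ∀ {h} → ¬ R ⊑ h → Av h → Av (zero ∷ h)
  zero-allowed R⋢h av = cons (λ { (_ ∷ R⊑h) → R⋢h R⊑h }) av

  nonzero-allowed : ∀ {x h} → x ≢ zero → Av h → Av (x ∷ h)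
  nonzero-allowed x≢0 av = cons (λ { (0≡x ∷ _) → x≢0 (sym 0≡x) }) av

  greedy : List A → (m : ℕ) → Vec A m
  greedy h zero = []
  greedy h (suc m) with R? h
  ... | yes _ = one ∷ greedy (one ∷ h) m
  ... | no _ = zero ∷ greedy (zero ∷ h) m

  greedy-avoids : ∀ m h → Av h → Av (after h (greedy h m))
  greedy-avoids zero h av = av
  greedy-avoids (suc m) h av with R? h
  ... | yes _ = greedy-avoids m (one ∷ h) (nonzero-allowed (λ ()) av)
  ... | no R⋢h = greedy-avoids m (zero ∷ h) (zero-allowed R⋢h av)

  -- In even parity the greedy completion precedes every other completion:
  -- 0 and 1 have even weight, so the parity never changes along it.
  greedy-precedes : ∀ m h c → c % 2 ≡ 0 → (z : Vec A m) → Av (after h z) →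
                    z ≡ greedy h m ⊎ Lt c (greedy h m) z
  greedy-precedes zero h c _ [] _ = inj₁ refl
  greedy-precedes (suc m) h c even (x ∷ z) av with R? h | x
  ... | no _ | zero = map⊎ (cong (zero ∷_)) (λ lt → inj₁ (refl , lt))
                           (greedy-precedes m (zero ∷ h) (c + 0) (%2-+ c 0 even refl) z av)
  ... | no _ | suc _ = inj₂ (inj₂ (inj₁ (even , s≤s z≤n)))
  ... | yes R⊑h | zero = ⊥-elim (zero-blocked R⊑h (avoiding-drop (toList z) av))
  ... | yes _ | suc zero = map⊎ (cong (one ∷_)) (λ lt → inj₁ (refl , lt))
                                (greedy-precedes m (one ∷ h) (c + 2) (%2-+ c 2 even refl) z av)
  ... | yes _ | suc (suc _) = inj₂ (inj₂ (inj₁ (even , s≤s (s≤s z≤n))))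

  IsFirst IsLast : ℕ → List A → ∀ {m} → Vec A m → Set
  IsFirst c h z = ∀ w → Av (after h w) → ¬ Lt c w z
  IsLast c h z = ∀ w → Av (after h w) → ¬ Lt c z w

  last⇒first : ∀ {c h m} {z : Vec A m} → IsLast c h z → IsFirst (suc c) h z
  last⇒first last w av w<z = last w av (Lt-unflip w<z)

  first-even : ∀ {m} h c → c % 2 ≡ 0 → (z : Vec A m) → Av (after h z) → IsFirst c h z → z ≡ greedy h m
  first-even {m} h c even z av first with greedy-precedes m h c even z av
  ... | inj₁ z≡greedy = z≡greedy
  ... | inj₂ greedy<z = ⊥-elim (first (greedy h m) (greedy-avoids m h (avoiding-drop (toList z) av)) greedy<z)

  -- In odd parity, top comes first, and its odd weight restores even parity.
  first-odd : ∀ {m} h c → c % 2 ≡ 1 → (z : Vec A (suc m)) → Av (after h z) → IsFirst c h z →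
              z ≡ top ∷ greedy (top ∷ h) m
  first-odd {m} h c odd (y ∷ z) av first with y Fin.≟ top
  ... | yes refl = cong (top ∷_) (first-even (top ∷ h) _ (after-top c odd) z av
                                    (λ w av' w<z → first (top ∷ w) av' (inj₁ (refl , w<z))))
  ... | no y≢top = ⊥-elim (first (top ∷ greedy (top ∷ h) m)
                                 (greedy-avoids m (top ∷ h) (nonzero-allowed top≢0 (avoiding-drop (y ∷ toList z) av)))
                                 (inj₂ (inj₂ (odd , below-top y≢top))))

  -- The shape of greedy completions.  R = 0^j d R' cannot start inside a run
  -- of more than j zeros, nor before a nonzero symbol preceded by fewer than j zeros.

  greedy-zeros : ∀ m h → replicate (suc j) zero ⊑ h → greedy h m ≡ zeros m
  greedy-zeros zero h _ = refl
  greedy-zeros (suc m) h zeros⊑h with R? h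
  ... | yes R⊑h = ⊥-elim (zeros-then-nonzero j d≢0 (subst (_⊑ h) R-shape R⊑h) zeros⊑h)
  ... | no _ = cong (zero ∷_) (greedy-zeros m (zero ∷ h) (refl ∷ zeros-shorten j zeros⊑h))

  R-at-j : ∀ {e h} → R ⊑ replicate j zero ++ e ∷ h → d ≡ e
  R-at-j {e} {h} R⊑ =
    ⊑-head (Prefix.++⁻ {as = replicate j zero} refl (subst (_⊑ replicate j zero ++ e ∷ h) R-shape R⊑))

  -- After a nonzero e the next j symbols are 0; the following one, E, is
  -- decided once the history reads 0^j e h, and is followed by zeros only.
  greedy-approach : ∀ a i m {e h E} → i + a ≡ j → e ≢ zero →
    (∀ m → greedy (replicate j zero ++ e ∷ h) (suc m) ≡ E ∷ zeros m) →
    greedy (replicate i zero ++ e ∷ h) m ≡ spike a E m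
  greedy-approach a i zero _ _ _ = refl
  greedy-approach zero i (suc m) {e} {h} {E} i+0≡j _ decided =
    subst (λ i → greedy (replicate i zero ++ e ∷ h) (suc m) ≡ E ∷ zeros m)
          (trans (sym i+0≡j) (+-identityʳ i)) (decided m)
  greedy-approach (suc a) i (suc m) {e} {h} i+a≡j e≢0 decided with R? (replicate i zero ++ e ∷ h)
  ... | yes R⊑ = ⊥-elim (zeros-too-long i j e≢0 i<j (subst (_⊑ _) R-shape R⊑))
    where
      i<j : i < j
      i<j = subst (i <_) i+a≡j (m<m+n i (s≤s z≤n))
  ... | no _ = cong (zero ∷_) (greedy-approach a (suc i) m (trans (sym (+-suc i a)) i+a≡j) e≢0 decided)

  greedy-blocked : ∀ {e h} → ¬ R ⊑ replicate j zero ++ e ∷ h → ∀ m →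
                   greedy (replicate j zero ++ e ∷ h) (suc m) ≡ zero ∷ zeros m
  greedy-blocked {e} {h} R⋢ m with R? (replicate j zero ++ e ∷ h)
  ... | yes R⊑ = ⊥-elim (R⋢ R⊑)
  ... | no _ = cong (zero ∷_) (greedy-zeros m _ (refl ∷ ⊑-++ (replicate j zero) (e ∷ h)))

  -- After writing 1, no further 1 follows: that would need R at both
  -- Y and 0^j 1 Y, which no-overlap rules out.
  greedy-open : ∀ {e h} → R ⊑ replicate j zero ++ e ∷ h → ∀ m →
                greedy (replicate j zero ++ e ∷ h) (suc m) ≡ one ∷ zeros m
  greedy-open {e} {h} R⊑Y m with R? (replicate j zero ++ e ∷ h)
  ... | no R⋢ = ⊥-elim (R⋢ R⊑Y)
  ... | yes _ = cong (one ∷_) (trans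
        (greedy-approach j 0 m refl (λ ()) (greedy-blocked (no-overlap g j g0∉V _ R⊑Y)))
        (spike-zero j m))

  greedy-spike : ∀ {e} h m → e ≢ zero → Σ A λ E → greedy (e ∷ h) m ≡ spike j E m × (E ≡ zero ⊎ d ≡ e)
  greedy-spike {e} h m e≢0 with R? (replicate j zero ++ e ∷ h)
  ... | yes R⊑ = one , greedy-approach j 0 m refl e≢0 (greedy-open R⊑) , inj₂ (R-at-j R⊑)
  ... | no R⋢ = zero , greedy-approach j 0 m refl e≢0 (greedy-blocked R⋢) , inj₁ refl

  -- The bound trailZeros f + 1.
  B : ℕ
  B = suc j + 1

  -- The three configurations of completions after adjacent symbols x < y:
  -- (0, 1) in even parity, and nonzero x with both tails greedy or both topped.

  close-zero-one : ∀ m h → Close B (zero ∷ top ∷ greedy (top ∷ zero ∷ h) m) (one ∷ greedy (one ∷ h) (suc m))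
  close-zero-one m h with greedy-spike (zero ∷ h) m top≢0 | greedy-spike h (suc m) (λ ())
  ... | E₁ , eq₁ , E₁-ok | E₂ , eq₂ , E₂-ok =
    subst₂ (λ U V → Close B (zero ∷ top ∷ U) (one ∷ V)) (sym eq₁) (sym eq₂)
      (close-mixed j (λ ()) (spike-once E₁-ok E₂-ok))
    where
      -- d cannot be both top and 1
      spike-once : E₁ ≡ zero ⊎ d ≡ top → E₂ ≡ zero ⊎ d ≡ one → E₁ ≡ zero ⊎ E₂ ≡ zero
      spike-once (inj₁ E₁≡0) _ = inj₁ E₁≡0
      spike-once (inj₂ _) (inj₁ E₂≡0) = inj₂ E₂≡0
      spike-once (inj₂ d≡top) (inj₂ d≡one) with trans (sym d≡top) d≡one
      ... | ()

  close-greedy : ∀ m h {x y : A} → x ≢ y → x ≢ zero → y ≢ zero →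
                 Close B (x ∷ greedy (x ∷ h) m) (y ∷ greedy (y ∷ h) m)
  close-greedy m h x≢y x≢0 y≢0 with greedy-spike h m x≢0 | greedy-spike h m y≢0
  ... | _ , eq₁ , _ | _ , eq₂ , _ =
    subst₂ (λ U V → Close B (_ ∷ U) (_ ∷ V)) (sym eq₁) (sym eq₂) (close-plain j x≢y)

  close-top-greedy : ∀ m h {x y : A} → x ≢ y →
    Close B (x ∷ top ∷ greedy (top ∷ x ∷ h) m) (y ∷ top ∷ greedy (top ∷ y ∷ h) m)
  close-top-greedy m h {x} {y} x≢y with greedy-spike (x ∷ h) m top≢0 | greedy-spike (y ∷ h) m top≢0
  ... | _ , eq₁ , _ | _ , eq₂ , _ =
    subst₂ (λ U V → Close B (x ∷ top ∷ U) (y ∷ top ∷ V)) (sym eq₁) (sym eq₂) (close-topped j x≢y)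

  successor-≢ : ∀ {x y : A} → toℕ y ≡ suc (toℕ x) → x ≢ y
  successor-≢ y≡x+1 refl = 1+n≢n (sym y≡x+1)

  successor-≢0 : ∀ {y : A} {n} → toℕ y ≡ suc n → y ≢ zero
  successor-≢0 () refl

  weight-step : ∀ c (x : Fin (2 + r)) (y : A) → toℕ y ≡ suc (toℕ (suc x)) →
                c + weight (toℕ y) ≡ suc (c + weight (toℕ (suc x)))
  weight-step c x y y≡x+1 = trans (cong (λ v → c + weight v) y≡x+1) (+-suc c _)

  -- y = x + 1 at even parity c; the tail S of x is first for parity
  -- c + w(x) + 1 (it is last for c + w(x)), the tail T of y is first for c + w(y).
  adjacent-tails : ∀ m h c (x y : A) (S T : Vec A m) → c % 2 ≡ 0 → toℕ y ≡ suc (toℕ x) →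
    Av (after (x ∷ h) S) → Av (after (y ∷ h) T) →
    IsFirst (suc (c + weight (toℕ x))) (x ∷ h) S → IsFirst (c + weight (toℕ y)) (y ∷ h) T →
    Close B (x ∷ S) (y ∷ T)
  adjacent-tails zero h c x y [] [] _ y≡x+1 _ _ _ _ =
    close-plain j {E₁ = zero} {E₂ = zero} (successor-≢ y≡x+1)
  adjacent-tails (suc m) h c zero zero S T _ () _ _ _ _
  adjacent-tails (suc m) h c zero (suc (suc _)) S T _ () _ _ _ _
  adjacent-tails (suc m) h c zero (suc zero) S T even _ avS avT firstS firstT =
    subst₂ (λ U V → Close B (zero ∷ U) (one ∷ V))
      (sym (first-odd (zero ∷ h) _ (suc-even (c + 0) (%2-+ c 0 even refl)) S avS firstS))
      (sym (first-even (one ∷ h) _ (%2-+ c 2 even refl) T avT firstT))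
      (close-zero-one m h)
  adjacent-tails (suc m) h c (suc x) y S T even y≡x+1 avS avT firstS firstT
    with parity (c + weight (toℕ (suc x))) | weight-step c x y y≡x+1
  ... | inj₁ even-x | step =
    subst₂ (λ U V → Close B (suc x ∷ U) (y ∷ V))
      (sym (first-odd (suc x ∷ h) _ odd-x+1 S avS firstS))
      (sym (first-odd (y ∷ h) _ (subst (λ p → p % 2 ≡ 1) (sym step) odd-x+1) T avT firstT))
      (close-top-greedy m h (successor-≢ y≡x+1))
    where
      odd-x+1 : suc (c + weight (toℕ (suc x))) % 2 ≡ 1
      odd-x+1 = suc-even (c + weight (toℕ (suc x))) even-x
  ... | inj₂ odd-x | step =
    subst₂ (λ U V → Close B (suc x ∷ U) (y ∷ V))
      (sym (first-even (suc x ∷ h) _ even-x+1 S avS firstS))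
      (sym (first-even (y ∷ h) _ (subst (λ p → p % 2 ≡ 0) (sym step) even-x+1) T avT firstT))
      (close-greedy (suc m) h (successor-≢ y≡x+1) (λ ()) (successor-≢0 y≡x+1))
    where
      even-x+1 : suc (c + weight (toℕ (suc x))) % 2 ≡ 0
      even-x+1 = suc-odd (c + weight (toℕ (suc x))) odd-x

  Consecutive : ℕ → List A → ∀ {m} → Vec A m → Vec A m → Set
  Consecutive c h s t = ∀ w → Av (after h w) → ¬ (Lt c s w × Lt c w t)

  consecutive-flip : ∀ {c h m} {s t : Vec A m} → Consecutive c h s t → Consecutive (suc c) h t s
  consecutive-flip none-between w av (t<w , w<s) = none-between w av (Lt-unflip w<s , Lt-unflip t<w)

  -- First difference at even parity: the symbols are adjacent, since any z
  -- strictly between them followed by a greedy completion lies between s and t.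
  even-step : ∀ m h c (x y : A) (s t : Vec A m) → c % 2 ≡ 0 → toℕ x < toℕ y →
    Av (after (x ∷ h) s) → Av (after (y ∷ h) t) → Consecutive c h (x ∷ s) (y ∷ t) →
    Close B (x ∷ s) (y ∷ t)
  even-step m h c x y s t even x<y avs avt none-between =
    adjacent-tails m h c x y s t even (adjacent-symbols x y x<y nothing-between) avs avt
      (last⇒first λ w av s<w → none-between (x ∷ w) av (inj₁ (refl , s<w) , inj₂ (inj₁ (even , x<y))))
      (λ w av w<t → none-between (y ∷ w) av (inj₂ (inj₁ (even , x<y)) , inj₁ (refl , w<t)))
    where
      nothing-between : ∀ z → toℕ x < toℕ z → toℕ z < toℕ y → ⊥
      nothing-between z x<z z<y =
        none-between (z ∷ greedy (z ∷ h) m)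
             (greedy-avoids m (z ∷ h) (nonzero-allowed (above⇒nonzero x<z) (avoiding-drop (x ∷ toList s) avs)))
             (inj₂ (inj₁ (even , x<z)) , inj₂ (inj₁ (even , z<y)))

  -- Induction over the common prefix; an odd first difference is flipped to an even one.
  consecutive-close : ∀ m h c (s t : Vec A m) → Av (after h s) → Av (after h t) →
                      Lt c s t → Consecutive c h s t → Close B s t
  consecutive-close zero h c [] [] _ _ () _
  consecutive-close (suc m) h c (x ∷ s) (y ∷ t) avs avt (inj₁ (refl , s<t)) none-between =
    Close-∷ x (consecutive-close m (x ∷ h) _ s t avs avt s<t
      λ w av (s<w , w<t) → none-between (x ∷ w) av (inj₁ (refl , s<w) , inj₁ (refl , w<t)))
  consecutive-close (suc m) h c (x ∷ s) (y ∷ t) avs avt (inj₂ (inj₁ (even , x<y))) none-between =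
    even-step m h c x y s t even x<y avs avt none-between
  consecutive-close (suc m) h c (x ∷ s) (y ∷ t) avs avt (inj₂ (inj₂ (odd , y<x))) none-between =
    Close-sym (even-step m h (suc c) y x t s (suc-odd c odd) y<x avt avs (consecutive-flip none-between))

  reverse-f : reverse (g ∷ʳ zero) ≡ zero ∷ R
  reverse-f = reverse-++ g [ zero ]

  avoids⇒Av : ∀ {n} (w : Word (3 + r) n) → Avoids (g ∷ʳ zero) w → Av (after [] w)
  avoids⇒Av w avoids = ¬factor⇒avoiding _ λ factor →
    avoids (factor-reverse⁻ (subst (λ u → IsFactor u _) (sym reverse-f) factor))

  Av⇒avoids : ∀ {n} (w : Word (3 + r) n) → Av (after [] w) → Avoids (g ∷ʳ zero) w
  Av⇒avoids w av factor =
    avoiding⇒¬factor _ av (subst (λ u → IsFactor u _) reverse-f (factor-reverse factor))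

  consecutive-words-close : ∀ n (s t : Word (3 + r) n) →
    Avoids (g ∷ʳ zero) s → Avoids (g ∷ʳ zero) t → s ◁ t →
    ((w : Word (3 + r) n) → Avoids (g ∷ʳ zero) w → ¬ ((s ◁ w) × (w ◁ t))) → Close B s t
  consecutive-words-close n s t avs avt s◁t none-between =
    consecutive-close n [] 0 s t (avoids⇒Av s avs) (avoids⇒Av t avt) s◁t
      λ w av → none-between w (Av⇒avoids w av)

theorem5 : (q : ℕ) → 3 ≤ q → q % 2 ≡ 1 →
    (f : List (Fin q)) →
    (Σ (List (Fin q)) λ g → Σ (Fin q) λ x → (f ≡ g ∷ʳ x) × (toℕ x ≡ 0)) →
    ¬ InV f →
    (n : ℕ) → 1 ≤ n →
    (s t : Word q n) → Avoids f s → Avoids f t → s ◁ t →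
    ((w : Word q n) → Avoids f w → ¬ ((s ◁ w) × (w ◁ t))) →
    (diffCount s t ≤ 3)
    × ((i j : Fin n) → lookup s i ≢ lookup t i → lookup s j ≢ lookup t j →
         toℕ j ∸ toℕ i ≤ trailZeros f + 1)
-- Here q = 3 + r and the last symbol of f is 0; the bound j + 2 of the
-- main argument is trailZeros f + 1.
theorem5 .(3 + r) (s≤s (s≤s (s≤s {n = r} _))) q-odd _ (g , zero , refl , _) g0∉V n _ s t avs avt s◁t none-between
  with nonzero-in-g g g0∉V
... | d , R' , d≢0 , R-shape =
  subst (λ b → Close b s t) (cong (_+ 1) (sym (trailZeros-∷ʳ-zero g)))
    (FixedPattern.consecutive-words-close r q-odd g g0∉V _ d R' d≢0 R-shape n s t avs avt s◁t none-between)
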